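{- Let $G$ be a finite connected graph, $u,v\in V(G)$, $\mathbf p$ a probability vector on $G$, and $T\subseteq V(G)$. If $T$ contains a set $C$ such that $u$ and $v$ lie in different components of $G\setminus C$ (a cutset separating $u$ from $v$), or if $u\in T$, or if $v\in T$, then \[P(u_0\to v_0 \text{ in } E_2^{\mathbf p,T}(\tilde G))= P(u_0\to v_1 \text{ in } E_2^{\mathbf p,T}(\tilde G));\] in particular $P(u_0\to v_0)\ge P(u_0\to v_1)$ in this model.
   Context: For a finite graph $G$, the bunkbed graph $\tilde G=G\times K_2$ has vertices $x_0,x_1$ for each $x\in V(G)$, a "vertical" edge $x_0x_1$ for each $x$, and "horizontal" edges $x_0y_0$, $x_1y_1$ for each edge $xy\in E(G)$. A probability vector on $G$ is $\mathbf p=(p_e)_{e\in E(G)}$ with $0\le p_e\le1$. Model $E_2^{\mathbf p,T}$: the vertical edge $x_0x_1$ is present exactly when $x\in T$; for each $e\in E(G)$ each of its two horizontal copies is present with probability $p_e$; all these events are independent. $P(x\to y)$ is the probability that there is a path from $x$ to $y$ using present edges.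
   Formalization: The probability vector $\mathbf p$ has rational entries. -}

module Defs where

open import Data.Nat using (ℕ; zero; suc; _*_)
open import Data.Bool using (Bool; true; false; _∧_; _∨_; not; if_then_else_)
open import Data.Fin using (Fin; zero; suc)
open import Data.Fin.Properties using () renaming (_≟_ to _≟F_)
open import Data.Fin.Subset using (Subset; _∉_)
open import Data.Vec using (lookup)
open import Data.Vec.Functional using () renaming (_∷_ to _∷ᶠ_)
open import Data.List using (List; []; _∷_; map; concatMap; foldr; allFin)
open import Data.Bool.ListAction using (any)
open import Data.Product using (Σ; _×_; _,_; proj₁; proj₂)
open import Data.Sum using (_⊎_)
open import Data.Rational using (ℚ; 0ℚ; 1ℚ; _+_; _-_) renaming (_*_ to _*ℚ_)
open import Relation.Binary.PropositionalEquality using (_≡_; _≢_)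
open import Relation.Nullary.Decidable using (⌊_⌋)

record Graph (n m : ℕ) : Set where
  field
    edge    : Fin m → Fin n × Fin n
    noLoop  : ∀ i → proj₁ (edge i) ≢ proj₂ (edge i)
    noMulti : ∀ i j →
      (edge i ≡ edge j ⊎ edge i ≡ (proj₂ (edge j) , proj₁ (edge j))) → i ≡ j
open Graph public

Adj : ∀ {n m} → Graph n m → Fin n → Fin n → Set
Adj G x y = Σ (Fin _) λ i → edge G i ≡ (x , y) ⊎ edge G i ≡ (y , x)

-- Walks in G \ C : ConnAvoid G C x y means there is a path from x to y
-- all of whose vertices after x lie outside C (x itself is required
-- to lie outside C separately where relevant).
data ConnAvoid {n m} (G : Graph n m) (C : Subset n) : Fin n → Fin n → Set where
  here : ∀ {x} → ConnAvoid G C x x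
  step : ∀ {x y z} → ConnAvoid G C x y → Adj G y z → z ∉ C → ConnAvoid G C x z

Connected : ∀ {n m} → Graph n m → Set
Connected {n} G = ∀ x y → ConnAvoid G (Data.Fin.Subset.⊥) x y

Separates : ∀ {n m} → Graph n m → Subset n → Fin n → Fin n → Set
Separates G C u v = u ∉ C × v ∉ C × (ConnAvoid G C u v → Data.Empty.⊥)
  where import Data.Empty

-- Bunkbed graph.  Vertex x_0 is (x , false), x_1 is (x , true).
-- A configuration of horizontal edges assigns to each edge i a pair
-- (presence of copy in layer 0 , presence of copy in layer 1).

BVertex : ℕ → Set
BVertex n = Fin n × Bool

Config : ℕ → Set
Config m = Fin m → Bool × Bool

_≟B_ : Bool → Bool → Bool
true  ≟B true  = true
false ≟B false = true
_     ≟B _     = false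

eqF : ∀ {n} → Fin n → Fin n → Bool
eqF x y = ⌊ x ≟F y ⌋

layerBit : Bool × Bool → Bool → Bool
layerBit (b0 , b1) false = b0
layerBit (b0 , b1) true  = b1

openEdge : ∀ {n m} → Graph n m → Subset n → Config m →
           BVertex n → BVertex n → Bool
openEdge {n} {m} G T ω (x , l) (y , l') =
  (eqF x y ∧ not (l ≟B l') ∧ lookup T x)
  ∨ (l ≟B l' ∧ any horiz (allFin m))
  where
  horiz : Fin m → Bool
  horiz i with edge G i
  ... | (a , b) = layerBit (ω i) l ∧ ((eqF x a ∧ eqF y b) ∨ (eqF x b ∧ eqF y a))

allBVertices : ∀ n → List (BVertex n)
allBVertices n = concatMap (λ x → (x , false) ∷ (x , true) ∷ []) (allFin n)

reachWithin : ∀ {n m} → Graph n m → Subset n → Config m →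
              BVertex n → ℕ → BVertex n → Bool
reachWithin G T ω (s , ls) zero (z , lz) = eqF s z ∧ (ls ≟B lz)
reachWithin {n} G T ω s (suc k) z =
  reachWithin G T ω s k z ∨
  any (λ w → reachWithin G T ω s k w ∧ openEdge G T ω w z) (allBVertices n)

-- s → t by an open path (the bunkbed graph has 2n vertices, so paths of
-- length ≤ 2n suffice).
Connects : ∀ {n m} → Graph n m → Subset n → Config m →
           BVertex n → BVertex n → Bool
Connects {n} G T ω s t = reachWithin G T ω s (2 * n) t

allConfigs : ∀ m → List (Config m)
allConfigs zero    = (λ ()) ∷ []
allConfigs (suc m) =
  concatMap (λ b → map (λ f → b ∷ᶠ f) (allConfigs m))
    ((false , false) ∷ (false , true) ∷ (true , false) ∷ (true , true) ∷ [])

bitWeight : ℚ → Bool → ℚ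
bitWeight q true  = q
bitWeight q false = 1ℚ - q

weight : ∀ {m} → (Fin m → ℚ) → Config m → ℚ
weight {m} p ω =
  foldr (λ i acc → (bitWeight (p i) (proj₁ (ω i)) *ℚ bitWeight (p i) (proj₂ (ω i))) *ℚ acc)
        1ℚ (allFin m)

sumℚ : List ℚ → ℚ
sumℚ = foldr _+_ 0ℚ

Prob : ∀ {n m} → Graph n m → (Fin m → ℚ) → Subset n →
       BVertex n → BVertex n → ℚ
Prob {n} {m} G p T s t =
  sumℚ (map (λ ω → if Connects G T ω s t then weight p ω else 0ℚ) (allConfigs m))

-- Label each vertex x by a layer shift f x and each edge e by a shift s e, such that every
-- endpoint x of e lies in T or has f x = s e.  Swapping the two copies of every edge e with
-- s e = 1 is a weight-preserving involution on configurations, and it carries an open path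
-- through x_l to one through x_(l + f x), layers taken mod 2: the copy of e in layer l becomes
-- its copy in layer l + s e, and each endpoint either already has f x = s e or can switch
-- layers along its open vertical edge.  When u ∈ T or f u = 0, and v ∈ T or f v = 1, this
-- matches the configurations with u_0 → v_0 to those with u_0 → v_1, so both probabilities
-- agree.  Take f ≡ 1 if u ∈ T, f ≡ 0 if v ∈ T, and for a cutset C ⊆ T let f x = 1 exactly when
-- x is not reachable from u in G ∖ C: f is constant along edges of G ∖ C, and the vertices of C
-- lie in T.

module Submission where

open import Defs
open import Algebra.Bundles using (CommutativeMonoid)
open import Data.Bool as Bool
  using (Bool; true; false; _∧_; _∨_; not; _xor_; if_then_else_)
open import Data.Bool.Properties using (T-∧; T-∨; T-≡)
open import Data.Bool.ListAction using (any; or)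
open import Data.Fin using (Fin; zero; suc) renaming (_≟_ to _≟ᶠ_)
open import Data.Fin.Properties using (any?)
open import Data.Fin.Subset using (Subset; _∈_; _∉_; _⊆_)
open import Data.Fin.Subset.Properties using (_∈?_)
open import Data.List using (List; []; _∷_; _++_; map; concatMap; length; allFin)
open import Data.List.Membership.Propositional using (_─_; lose) renaming (_∈_ to _∈ˡ_)
open import Data.List.Membership.Propositional.Properties using (∈-allFin; ∈-concatMap⁺)
open import Data.List.Properties using (length-removeAt′; length-tabulate; map-∘; map-cong; foldr-cong)
open import Data.List.Relation.Unary.Any as Any using (here; there; index; satisfied)
open import Data.List.Relation.Unary.Any.Properties using (any⁺; any⁻)
open import Data.Nat as ℕ using (ℕ; zero; suc)
open import Data.Nat.Properties using (suc-injective; *-suc)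
open import Data.Product using (Σ; ∃; _×_; _,_; proj₁; proj₂; swap; uncurry; map₂)
open import Data.Product.Properties using (≡-dec)
open import Data.Rational using (ℚ; 0ℚ; 1ℚ; _+_; _*_; _≤_; _≥_)
open import Data.Rational.Properties using (+-assoc; +-identityˡ; *-comm; +-0-commutativeMonoid; ≤-reflexive)
open import Data.Sum using (_⊎_; inj₁; inj₂; reduce) renaming (map to map⊎; map₂ to map₂⊎; swap to swap⊎)
open import Data.Vec using (lookup)
open import Data.Vec.Functional using () renaming (_∷_ to _∷ᶠ_)
open import Data.Vec.Properties using ([]=⇒lookup; lookup⇒[]=)
open import Function using (_∘_; id; _⇔_; mk⇔; Equivalence)
open import Level using (0ℓ)
open import Relation.Binary using (Rel; Decidable; DecidableEquality)
open import Relation.Binary.Construct.Closure.ReflexiveTransitive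
  using (Star; ε; _◅_; _◅◅_; kleisliStar; foldl) renaming (map to mapStar)
open import Relation.Binary.PropositionalEquality
  using (_≡_; _≢_; refl; sym; trans; cong; cong₂; subst; module ≡-Reasoning)
open import Relation.Nullary using (¬_; Dec; yes; no; does; contradiction)
open import Relation.Nullary.Decidable
  using (⌊_⌋; map′; T?; _×-dec_; _⊎-dec_; ¬?; toWitness; fromWitness; dec-true; dec-false; does-⇔)
open import Relation.Unary using (Pred; _∩_)
open import Algebra.Properties.CommutativeSemigroup
  (CommutativeMonoid.commutativeSemigroup +-0-commutativeMonoid) using (x∙yz≈y∙xz)

open Equivalence using (to; from)

∈-─ : ∀ {a} {A : Set a} {x y : A} {xs} → y ∈ˡ xs → y ≢ x → (x∈xs : x ∈ˡ xs) → y ∈ˡ xs ─ x∈xs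
∈-─ (here refl)  y≢x (here refl)  = contradiction refl y≢x
∈-─ (there y∈xs) _   (here _)     = y∈xs
∈-─ (here y≡x)   _   (there _)    = here y≡x
∈-─ (there y∈xs) y≢x (there x∈xs) = there (∈-─ y∈xs y≢x x∈xs)

module BoundedReachability {a} {V : Set a}
  (_==_ : V → V → Bool)
  (==-sound : ∀ {x y} → Bool.T (x == y) → x ≡ y) (==-refl : ∀ x → Bool.T (x == x))
  (adj : V → V → Bool) (vertices : List V) (complete : ∀ x → x ∈ˡ vertices) where

  Edge : Rel V 0ℓ
  Edge x y = Bool.T (adj x y)

  _≟_ : DecidableEquality V
  x ≟ y = map′ ==-sound (λ { refl → ==-refl x }) (T? (x == y))

  reach : V → ℕ → V → Bool
  reach s zero    t = s == t
  reach s (suc k) t = reach s k t ∨ any (λ w → reach s k w ∧ adj w t) vertices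

  reach-sound : ∀ s k t → Bool.T (reach s k t) → Star Edge s t
  reach-sound s zero t r with ==-sound r
  ... | refl = ε
  reach-sound s (suc k) t r with to T-∨ r
  ... | inj₁ r′ = reach-sound s k t r′
  ... | inj₂ r′ with satisfied (any⁻ _ vertices r′)
  ...   | w , r″ with to T-∧ r″
  ...     | rw , ewt = reach-sound s k w rw ◅◅ ewt ◅ ε

  reach-suc : ∀ {s} k {t} → Bool.T (reach s k t) → Bool.T (reach s (suc k) t)
  reach-suc _ r = from T-∨ (inj₁ r)

  reach-refl : ∀ k s → Bool.T (reach s k s)
  reach-refl zero    s = ==-refl s
  reach-refl (suc k) s = reach-suc k (reach-refl k s)

  reach-▻ : ∀ {s} k {w t} → Bool.T (reach s k w) → Edge w t → Bool.T (reach s (suc k) t)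
  reach-▻ _ {w} r e = from T-∨ (inj₂ (any⁺ _ (lose (complete w) (from T-∧ (r , e)))))

  reach-◅ : ∀ {s b} k {t} → Edge s b → Bool.T (reach b k t) → Bool.T (reach s (suc k) t)
  reach-◅ {s} zero e r with ==-sound r
  ... | refl = reach-▻ zero (reach-refl zero s) e
  reach-◅ (suc k) e r with to T-∨ r
  ... | inj₁ r′ = reach-suc (suc k) (reach-◅ k e r′)
  ... | inj₂ r′ with satisfied (any⁻ _ vertices r′)
  ...   | w , r″ with to T-∧ r″
  ...     | rw , ewt = reach-▻ (suc k) (reach-◅ k e rw) ewt

  Step : ∀ {p} → Pred V p → Rel V p
  Step P x y = Edge x y × P y

  avoid-return-from : ∀ {p} {P : Pred V p} {s x t} → s ≢ t → Star (Step P) x t →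
    Star (Step (P ∩ (_≢ s))) x t ⊎ Star (Step (P ∩ (_≢ s))) s t
  avoid-return-from s≢t ε = inj₁ ε
  avoid-return-from {s = s} s≢t (_◅_ {j = y} (e , Py) w) with avoid-return-from s≢t w
  ... | inj₂ w′ = inj₂ w′
  ... | inj₁ w′ with y ≟ s
  ...   | yes refl = inj₂ w′
  ...   | no y≢s   = inj₁ ((e , Py , y≢s) ◅ w′)

  avoid-return : ∀ {p} {P : Pred V p} {s t} → s ≢ t → Star (Step P) s t → Star (Step (P ∩ (_≢ s))) s t
  avoid-return s≢t w = reduce (avoid-return-from s≢t w)

  -- After rerouting the walk so that it never returns to s, everything beyond its first step
  -- lies in L ─ s, which is one element shorter.
  reach-within : ∀ {N} (L : List V) → length L ≡ N → ∀ {s t} → s ∈ˡ L →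
    Star (Step (_∈ˡ L)) s t → Bool.T (reach s N t)
  reach-within {zero} (_ ∷ _) ()
  reach-within {suc N} L len {s} {t} s∈L w with s ≟ t
  ... | yes refl = reach-refl (suc N) s
  ... | no s≢t with avoid-return s≢t w
  ...   | ε = contradiction refl s≢t
  ...   | (e , y∈L , y≢s) ◅ w′ =
    reach-◅ N e (reach-within (L ─ s∈L) len′ (∈-─ y∈L y≢s s∈L)
      (mapStar (map₂ (λ (x∈L , x≢s) → ∈-─ x∈L x≢s s∈L)) w′))
    where
    len′ : length (L ─ s∈L) ≡ N
    len′ = suc-injective (trans (sym (length-removeAt′ L (index s∈L))) len)

  reach-complete : ∀ {s t} → Star Edge s t → Bool.T (reach s (length vertices) t)
  reach-complete {s} w = reach-within vertices refl (complete s) (mapStar (λ {_} {y} e → e , complete y) w)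

  star? : Decidable (Star Edge)
  star? s t = map′ (reach-sound s (length vertices) t) reach-complete (T? (reach s (length vertices) t))

Joins : ∀ {n m} → Graph n m → Fin m → Fin n → Fin n → Set
Joins G i x y = (x ≡ proj₁ (edge G i) × y ≡ proj₂ (edge G i))
              ⊎ (x ≡ proj₂ (edge G i) × y ≡ proj₁ (edge G i))

T-eqF-pair : ∀ {n} {x a y b : Fin n} → Bool.T (eqF x a ∧ eqF y b) ⇔ (x ≡ a × y ≡ b)
T-eqF-pair {x = x} {a} {y} {b} = mk⇔
  (λ t → let p , q = to (T-∧ {eqF x a}) t in toWitness p , toWitness q)
  (λ (p , q) → from (T-∧ {eqF x a}) (fromWitness {a? = x ≟ᶠ a} p , fromWitness {a? = y ≟ᶠ b} q))

∈⇒T-lookup : ∀ {n x} {S : Subset n} → x ∈ S → Bool.T (lookup S x)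
∈⇒T-lookup x∈S = from T-≡ ([]=⇒lookup x∈S)

T-lookup⇒∈ : ∀ {n x} {S : Subset n} → Bool.T (lookup S x) → x ∈ S
T-lookup⇒∈ {x = x} {S} t = lookup⇒[]= x S (to T-≡ t)

sameVertex : ∀ {n} → BVertex n → BVertex n → Bool
sameVertex (x , l) (y , l′) = eqF x y ∧ (l ≟B l′)

≟B-sound : ∀ {l l′} → Bool.T (l ≟B l′) → l ≡ l′
≟B-sound {false} {false} _ = refl
≟B-sound {true}  {true}  _ = refl

≟B-refl : ∀ l → Bool.T (l ≟B l)
≟B-refl false = _
≟B-refl true  = _

≟B-not : ∀ l → Bool.T (not (l ≟B not l))
≟B-not false = _
≟B-not true  = _

sameVertex-sound : ∀ {n} {a b : BVertex n} → Bool.T (sameVertex a b) → a ≡ b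
sameVertex-sound t with to T-∧ t
... | x≡y , l≡l′ = cong₂ _,_ (toWitness x≡y) (≟B-sound l≡l′)

sameVertex-refl : ∀ {n} (a : BVertex n) → Bool.T (sameVertex a a)
sameVertex-refl (x , l) = from T-∧ (fromWitness refl , ≟B-refl l)

∈-allBVertices : ∀ {n} (a : BVertex n) → a ∈ˡ allBVertices n
∈-allBVertices (x , l) = ∈-concatMap⁺ _ (Any.map (λ { refl → layer l }) (∈-allFin x))
  where
  layer : ∀ l → (x , l) ∈ˡ (x , false) ∷ (x , true) ∷ []
  layer false = here refl
  layer true  = there (here refl)

length-allBVertices : ∀ n → length (allBVertices n) ≡ 2 ℕ.* n
length-allBVertices n = trans (go (allFin n)) (cong (2 ℕ.*_) (length-tabulate {n = n} id))
  where
  go : ∀ {k} (xs : List (Fin k)) →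
    length (concatMap (λ x → (x , false) ∷ (x , true) ∷ []) xs) ≡ 2 ℕ.* length xs
  go []       = refl
  go (x ∷ xs) = trans (cong (2 ℕ.+_) (go xs)) (sym (*-suc 2 (length xs)))

module _ {n m} (G : Graph n m) (T : Subset n) where

  Open : Config m → Rel (BVertex n) 0ℓ
  Open ω a b = Bool.T (openEdge G T ω a b)

  open-vertical : ∀ ω {x} → x ∈ T → ∀ l → Open ω (x , l) (x , not l)
  open-vertical ω {x} x∈T l =
    from (T-∨ {eqF x x ∧ (not (l ≟B not l) ∧ lookup T x)}) (inj₁ (from (T-∧ {eqF x x})
      (fromWitness {a? = x ≟ᶠ x} refl , from (T-∧ {not (l ≟B not l)}) (≟B-not l , ∈⇒T-lookup x∈T))))

  vertical-walk : ∀ ω {x} → x ∈ T → ∀ l l′ → Star (Open ω) (x , l) (x , l′)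
  vertical-walk ω x∈T false false = ε
  vertical-walk ω x∈T true  true  = ε
  vertical-walk ω x∈T false true  = open-vertical ω x∈T false ◅ ε
  vertical-walk ω x∈T true  false = open-vertical ω x∈T true ◅ ε

  layer-change : ∀ ω {x l l′} → x ∈ T ⊎ l ≡ l′ → Star (Open ω) (x , l) (x , l′)
  layer-change ω (inj₁ x∈T) = vertical-walk ω x∈T _ _
  layer-change ω (inj₂ refl) = ε

  open-horizontal : ∀ ω {i x y} l → Bool.T (layerBit (ω i) l) → Joins G i x y → Open ω (x , l) (y , l)
  open-horizontal ω {i} l lb j =
    from T-∨ (inj₂ (from T-∧ (≟B-refl l , any⁺ _ (lose (∈-allFin i)
      (from T-∧ (lb , from T-∨ (map⊎ (from T-eqF-pair) (from T-eqF-pair) j)))))))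

  open-cases : ∀ ω {x l y l′} → Open ω (x , l) (y , l′) →
    (x ≡ y × x ∈ T) ⊎ (l ≡ l′ × ∃ λ i → Bool.T (layerBit (ω i) l) × Joins G i x y)
  open-cases ω {x} {l} {y} {l′} o with to (T-∨ {eqF x y ∧ (not (l ≟B l′) ∧ lookup T x)}) o
  ... | inj₁ v with to (T-∧ {eqF x y}) v
  ...   | x≡y , rest = inj₁ (toWitness x≡y , T-lookup⇒∈ (proj₂ (to (T-∧ {not (l ≟B l′)}) rest)))
  open-cases ω {x} {l} {y} {l′} o | inj₂ h with to (T-∧ {l ≟B l′}) h
  ... | l≡l′ , hor with satisfied (any⁻ _ (allFin m) hor)
  ...   | i , t with to T-∧ t
  ...     | lb , j = inj₂ (≟B-sound l≡l′ , i , lb , map⊎ (to T-eqF-pair) (to T-eqF-pair) (to T-∨ j))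

module _ {n m} (G : Graph n m) (T : Subset n) (ω : Config m) where

  private
    module R = BoundedReachability sameVertex sameVertex-sound sameVertex-refl
                 (openEdge G T ω) (allBVertices n) ∈-allBVertices

  reachWithin≡reach : ∀ s k t → reachWithin G T ω s k t ≡ R.reach s k t
  reachWithin≡reach s zero    t = refl
  reachWithin≡reach s (suc k) t = cong₂ _∨_ (reachWithin≡reach s k t)
    (cong or (map-cong (λ w → cong (_∧ openEdge G T ω w t) (reachWithin≡reach s k w)) (allBVertices n)))

  Connects⇔Star : ∀ {a b} → Bool.T (Connects G T ω a b) ⇔ Star (Open G T ω) a b
  Connects⇔Star {a} {b} = mk⇔
    (R.reach-sound a (2 ℕ.* n) b ∘ subst Bool.T (reachWithin≡reach a (2 ℕ.* n) b))
    (subst Bool.T (sym (reachWithin≡reach a (2 ℕ.* n) b))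
      ∘ subst (λ k → Bool.T (R.reach a k b)) (length-allBVertices n) ∘ R.reach-complete)

Connects-≡ : ∀ {n m} {G : Graph n m} {T ω ω′ a b a′ b′} →
  Star (Open G T ω) a b ⇔ Star (Open G T ω′) a′ b′ → Connects G T ω a b ≡ Connects G T ω′ a′ b′
Connects-≡ {G = G} {T} {ω} {ω′} e = does-⇔
  (mk⇔ (from (Connects⇔Star G T ω′) ∘ to e ∘ to (Connects⇔Star G T ω))
       (from (Connects⇔Star G T ω) ∘ from e ∘ to (Connects⇔Star G T ω′)))
  (T? _) (T? _)

swapIf : Bool → Bool × Bool → Bool × Bool
swapIf c q = if c then swap q else q

swapIf-involutive : ∀ c q → swapIf c (swapIf c q) ≡ q
swapIf-involutive false q = refl
swapIf-involutive true  q = refl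

layerBit-swapIf : ∀ c q l → layerBit (swapIf c q) (c xor l) ≡ layerBit q l
layerBit-swapIf false q l     = refl
layerBit-swapIf true  q false = refl
layerBit-swapIf true  q true  = refl

flipConfig : ∀ {m} → (Fin m → Bool) → Config m → Config m
flipConfig s ω i = swapIf (s i) (ω i)

flipVertex : ∀ {n} → (Fin n → Bool) → BVertex n → BVertex n
flipVertex f (x , l) = (x , f x xor l)

Aligned : ∀ {n} → Subset n → (Fin n → Bool) → Bool → Fin n → Set
Aligned T f c x = x ∈ T ⊎ f x ≡ c

Compatible : ∀ {n m} → Graph n m → Subset n → (Fin n → Bool) → (Fin m → Bool) → Set
Compatible G T f s = ∀ i → Aligned T f (s i) (proj₁ (edge G i)) × Aligned T f (s i) (proj₂ (edge G i))

module _ {n m} (G : Graph n m) (T : Subset n) where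

  constant-compatible : ∀ b → Compatible G T (λ _ → b) (λ _ → b)
  constant-compatible b i = inj₂ refl , inj₂ refl

  module _ {f : Fin n → Bool} {s : Fin m → Bool} (c : Compatible G T f s) where

    compatible-joins : ∀ {i x y} → Joins G i x y → Aligned T f (s i) x × Aligned T f (s i) y
    compatible-joins (inj₁ (refl , refl)) = c _
    compatible-joins (inj₂ (refl , refl)) = swap (c _)

    flip-open : ∀ {ω ω′} → (∀ i → ω′ i ≡ swapIf (s i) (ω i)) → ∀ {a b} →
      Open G T ω a b → Star (Open G T ω′) (flipVertex f a) (flipVertex f b)
    flip-open {ω} {ω′} ω′≡ {x , l} {y , l′} o with open-cases G T ω {x} {l} {y} {l′} o
    ... | inj₁ (refl , x∈T) = vertical-walk G T ω′ x∈T _ _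
    ... | inj₂ (refl , i , lb , j) =
      let ax , ay = compatible-joins j in
      layer-change G T ω′ (map₂⊎ (cong (_xor l)) ax)
        ◅◅ open-horizontal G T ω′ (s i xor l) (subst Bool.T (sym lb≡) lb) j
        ◅ layer-change G T ω′ (map₂⊎ (sym ∘ cong (_xor l)) ay)
      where
      lb≡ : layerBit (ω′ i) (s i xor l) ≡ layerBit (ω i) l
      lb≡ = trans (cong (λ q → layerBit q (s i xor l)) (ω′≡ i)) (layerBit-swapIf (s i) (ω i) l)

    flip-star : ∀ {ω ω′} → (∀ i → ω′ i ≡ swapIf (s i) (ω i)) → ∀ {a b} →
      Star (Open G T ω) a b → Star (Open G T ω′) (flipVertex f a) (flipVertex f b)
    flip-star ω′≡ = kleisliStar (flipVertex f) (flip-open ω′≡)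

    connects-flip : ∀ {u v} → Aligned T f false u → Aligned T f true v → ∀ ω →
      Connects G T (flipConfig s ω) (u , false) (v , true) ≡ Connects G T ω (u , false) (v , false)
    connects-flip {u} hu hv ω = Connects-≡ (mk⇔
      (λ w → enter ◅◅ flip-star (λ i → sym (swapIf-involutive (s i) (ω i))) w
               ◅◅ layer-change G T ω (map₂⊎ (cong (_xor true)) hv))
      (λ w → enter ◅◅ flip-star (λ _ → refl) w ◅◅ layer-change G T _ (map₂⊎ (cong (_xor false)) hv)))
      where
      enter : ∀ {ω} → Star (Open G T ω) (u , false) (u , f u xor false)
      enter = layer-change G T _ (map₂⊎ (cong (_xor false) ∘ sym) hu)

  -- Pointwise equal configurations differ by the flip with all labels 0, which fixes every vertex.
  Connects-cong : ∀ {ω ω′} → (∀ i → ω i ≡ ω′ i) → ∀ a b → Connects G T ω a b ≡ Connects G T ω′ a b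
  Connects-cong e a b = Connects-≡ (mk⇔ (flip-star (constant-compatible false) (sym ∘ e))
                                        (flip-star (constant-compatible false) e))

∑ : ∀ {a} {A : Set a} → List A → (A → ℚ) → ℚ
∑ xs h = sumℚ (map h xs)

∑-cong : ∀ {a} {A : Set a} (xs : List A) {h h′ : A → ℚ} → (∀ x → h x ≡ h′ x) → ∑ xs h ≡ ∑ xs h′
∑-cong xs e = cong sumℚ (map-cong e xs)

∑-++ : ∀ {a} {A : Set a} (xs ys : List A) (h : A → ℚ) → ∑ (xs ++ ys) h ≡ ∑ xs h + ∑ ys h
∑-++ []       ys h = sym (+-identityˡ (∑ ys h))
∑-++ (x ∷ xs) ys h = trans (cong (h x +_) (∑-++ xs ys h)) (sym (+-assoc (h x) (∑ xs h) (∑ ys h)))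

∑-concatMap : ∀ {a b} {A : Set a} {B : Set b} (g : A → List B) (xs : List A) (h : B → ℚ) →
  ∑ (concatMap g xs) h ≡ ∑ xs (λ x → ∑ (g x) h)
∑-concatMap g []       h = refl
∑-concatMap g (x ∷ xs) h = trans (∑-++ (g x) (concatMap g xs) h) (cong (∑ (g x) h +_) (∑-concatMap g xs h))

layerPairs : List (Bool × Bool)
layerPairs = (false , false) ∷ (false , true) ∷ (true , false) ∷ (true , true) ∷ []

∑-allConfigs-suc : ∀ {m} (h : Config (suc m) → ℚ) →
  ∑ (allConfigs (suc m)) h ≡ ∑ layerPairs (λ b → ∑ (allConfigs m) (λ ω → h (b ∷ᶠ ω)))
∑-allConfigs-suc {m} h = trans (∑-concatMap (λ b → map (b ∷ᶠ_) (allConfigs m)) layerPairs h)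
  (∑-cong layerPairs (λ b → cong sumℚ (sym (map-∘ {g = h} {f = b ∷ᶠ_} (allConfigs m)))))

∑-layerPairs-swapIf : ∀ c (F : Bool × Bool → ℚ) → ∑ layerPairs (F ∘ swapIf c) ≡ ∑ layerPairs F
∑-layerPairs-swapIf false F = refl
∑-layerPairs-swapIf true  F = cong (F (false , false) +_) (x∙yz≈y∙xz (F (true , false)) (F (false , true)) _)

Pointwise-invariant : ∀ {m} → (Config m → ℚ) → Set
Pointwise-invariant {m} h = ∀ ω ω′ → (∀ i → ω i ≡ ω′ i) → h ω ≡ h ω′

∑-flipConfig : ∀ {m} (s : Fin m → Bool) (h : Config m → ℚ) → Pointwise-invariant h →
  ∑ (allConfigs m) (h ∘ flipConfig s) ≡ ∑ (allConfigs m) h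
∑-flipConfig {zero}  s h inv = cong (_+ 0ℚ) (inv _ _ (λ ()))
∑-flipConfig {suc m} s h inv = begin
  ∑ (allConfigs (suc m)) (h ∘ flipConfig s)
    ≡⟨ ∑-allConfigs-suc (h ∘ flipConfig s) ⟩
  ∑ layerPairs (λ b → ∑ (allConfigs m) (λ ω → h (flipConfig s (b ∷ᶠ ω))))
    ≡⟨ ∑-cong layerPairs (λ b → ∑-cong (allConfigs m) (λ ω → inv _ _ (flipConfig-∷ b ω))) ⟩
  ∑ layerPairs (λ b → ∑ (allConfigs m) (λ ω → h (swapIf (s zero) b ∷ᶠ flipConfig (s ∘ suc) ω)))
    ≡⟨ ∑-cong layerPairs (λ b → ∑-flipConfig (s ∘ suc) (h ∘ (swapIf (s zero) b ∷ᶠ_)) (inv-∷ _)) ⟩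
  ∑ layerPairs (λ b → ∑ (allConfigs m) (λ ω → h (swapIf (s zero) b ∷ᶠ ω)))
    ≡⟨ ∑-layerPairs-swapIf (s zero) (λ b → ∑ (allConfigs m) (λ ω → h (b ∷ᶠ ω))) ⟩
  ∑ layerPairs (λ b → ∑ (allConfigs m) (λ ω → h (b ∷ᶠ ω)))
    ≡⟨ sym (∑-allConfigs-suc h) ⟩
  ∑ (allConfigs (suc m)) h ∎
  where
  open ≡-Reasoning
  flipConfig-∷ : ∀ b ω i → flipConfig s (b ∷ᶠ ω) i ≡ (swapIf (s zero) b ∷ᶠ flipConfig (s ∘ suc) ω) i
  flipConfig-∷ b ω zero    = refl
  flipConfig-∷ b ω (suc i) = refl
  inv-∷ : ∀ b → Pointwise-invariant (h ∘ (b ∷ᶠ_))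
  inv-∷ b ω ω′ e = inv (b ∷ᶠ ω) (b ∷ᶠ ω′) λ { zero → refl ; (suc i) → e i }

pairWeight : ℚ → Bool × Bool → ℚ
pairWeight q (b₀ , b₁) = bitWeight q b₀ * bitWeight q b₁

weight-cong : ∀ {m} (p : Fin m → ℚ) {ω ω′} →
  (∀ i → pairWeight (p i) (ω i) ≡ pairWeight (p i) (ω′ i)) → weight p ω ≡ weight p ω′
weight-cong {m} p e = foldr-cong (λ i acc → cong (_* acc) (e i)) refl (allFin m)

weight-flipConfig : ∀ {m} (p : Fin m → ℚ) (s : Fin m → Bool) ω → weight p (flipConfig s ω) ≡ weight p ω
weight-flipConfig p s ω = weight-cong p {flipConfig s ω} {ω} (λ i → pairWeight-swapIf (s i) (p i) (ω i))
  where
  pairWeight-swapIf : ∀ c q r → pairWeight q (swapIf c r) ≡ pairWeight q r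
  pairWeight-swapIf false q r = refl
  pairWeight-swapIf true  q r = *-comm (bitWeight q (proj₂ r)) (bitWeight q (proj₁ r))

module _ {n m} (G : Graph n m) (p : Fin m → ℚ) (T : Subset n) where

  connectionWeight : BVertex n → BVertex n → Config m → ℚ
  connectionWeight a b ω = if Connects G T ω a b then weight p ω else 0ℚ

  connectionWeight-invariant : ∀ a b → Pointwise-invariant (connectionWeight a b)
  connectionWeight-invariant a b ω ω′ e =
    cong₂ (λ connected w → if connected then w else 0ℚ) (Connects-cong G T e a b)
          (weight-cong p {ω} {ω′} (λ i → cong (pairWeight (p i)) (e i)))

  prob-flip : ∀ {f s} → Compatible G T f s → ∀ {u v} → Aligned T f false u → Aligned T f true v →
    Prob G p T (u , false) (v , false) ≡ Prob G p T (u , false) (v , true)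
  prob-flip {s = s} c {u} {v} hu hv = begin
    ∑ (allConfigs m) (connectionWeight (u , false) (v , false))
      ≡⟨ ∑-cong (allConfigs m) (λ ω → sym (cong₂ (λ connected w → if connected then w else 0ℚ)
                                             (connects-flip G T c hu hv ω) (weight-flipConfig p s ω))) ⟩
    ∑ (allConfigs m) (connectionWeight (u , false) (v , true) ∘ flipConfig s)
      ≡⟨ ∑-flipConfig s _ (connectionWeight-invariant (u , false) (v , true)) ⟩
    ∑ (allConfigs m) (connectionWeight (u , false) (v , true)) ∎
    where open ≡-Reasoning

Adj-sym : ∀ {n m} {G : Graph n m} {x y} → Adj G x y → Adj G y x
Adj-sym (i , e) = i , swap⊎ e

module _ {n m} (G : Graph n m) (C : Subset n) where

  adj? : Decidable (Adj G)
  adj? x y = any? (λ i → ≡-dec _≟ᶠ_ _≟ᶠ_ (edge G i) (x , y) ⊎-dec ≡-dec _≟ᶠ_ _≟ᶠ_ (edge G i) (y , x))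

  private
    module R = BoundedReachability eqF toWitness (λ _ → fromWitness refl)
                 (λ y z → ⌊ adj? y z ×-dec ¬? (z ∈? C) ⌋) (allFin n) ∈-allFin

  star⇒connAvoid : ∀ {x y} → Star R.Edge x y → ConnAvoid G C x y
  star⇒connAvoid = foldl (ConnAvoid G C) (λ w e → uncurry (step w) (toWitness e)) here

  connAvoid⇒star : ∀ {x y} → ConnAvoid G C x y → Star R.Edge x y
  connAvoid⇒star here             = ε
  connAvoid⇒star (step w a z∉C) = connAvoid⇒star w ◅◅ fromWitness (a , z∉C) ◅ ε

  connAvoid? : Decidable (ConnAvoid G C)
  connAvoid? x y = map′ star⇒connAvoid connAvoid⇒star (R.star? x y)

module _ {n m} (G : Graph n m) (C : Subset n) (u : Fin n) where

  beyondCut : Fin n → Bool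
  beyondCut x = not (does (connAvoid? G C u x))

  -- Endpoints in C lie in T, so only an endpoint outside C constrains the shift of an edge.
  cutEdgeShift : Fin m → Bool
  cutEdgeShift i =
    if does (proj₁ (edge G i) ∈? C) then beyondCut (proj₂ (edge G i)) else beyondCut (proj₁ (edge G i))

  beyondCut-source : beyondCut u ≡ false
  beyondCut-source = cong not (dec-true (connAvoid? G C u u) here)

  beyondCut-separated : ∀ {v} → ¬ ConnAvoid G C u v → beyondCut v ≡ true
  beyondCut-separated {v} ¬w = cong not (dec-false (connAvoid? G C u v) ¬w)

  beyondCut-adjacent : ∀ {x y} → Adj G x y → x ∉ C → y ∉ C → beyondCut x ≡ beyondCut y
  beyondCut-adjacent {x} {y} a x∉C y∉C = cong not (does-⇔
    (mk⇔ (λ w → step {x = u} w a y∉C) (λ w → step {x = u} w (Adj-sym {G = G} a) x∉C))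
    (connAvoid? G C u x) (connAvoid? G C u y))

  cut-compatible : ∀ {T} → C ⊆ T → Compatible G T beyondCut cutEdgeShift
  cut-compatible {T} C⊆T i = aligned (a ∈? C)
    where
    a b : Fin n
    a = proj₁ (edge G i)
    b = proj₂ (edge G i)
    aligned : (d : Dec (a ∈ C)) → let c = if does d then beyondCut b else beyondCut a in
      Aligned T beyondCut c a × Aligned T beyondCut c b
    aligned (yes a∈C) = inj₁ (C⊆T a∈C) , inj₂ refl
    aligned (no a∉C) with b ∈? C
    ... | yes b∈C = inj₂ refl , inj₁ (C⊆T b∈C)
    ... | no b∉C  = inj₂ refl , inj₂ (sym (beyondCut-adjacent (i , inj₁ refl) a∉C b∉C))

prob-layers-equal : ∀ {n m} (G : Graph n m) (u v : Fin n) (p : Fin m → ℚ) (T : Subset n) →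
  ((Σ (Subset n) λ C → C ⊆ T × Separates G C u v) ⊎ u ∈ T ⊎ v ∈ T) →
  Prob G p T (u , false) (v , false) ≡ Prob G p T (u , false) (v , true)
prob-layers-equal G u v p T (inj₁ (C , C⊆T , _ , _ , separated)) =
  prob-flip G p T (cut-compatible G C u C⊆T)
    (inj₂ (beyondCut-source G C u)) (inj₂ (beyondCut-separated G C u separated))
prob-layers-equal G u v p T (inj₂ (inj₁ u∈T)) = prob-flip G p T (constant-compatible G T true) (inj₁ u∈T) (inj₂ refl)
prob-layers-equal G u v p T (inj₂ (inj₂ v∈T)) = prob-flip G p T (constant-compatible G T false) (inj₂ refl) (inj₁ v∈T)

mainTheorem2 : ∀ {n m} (G : Graph n m) → Connected G →
    (u v : Fin n) (p : Fin m → ℚ) → (∀ i → 0ℚ ≤ p i × p i ≤ 1ℚ) →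
    (T : Subset n) →
    ((Σ (Subset n) λ C → C ⊆ T × Separates G C u v) ⊎ u ∈ T ⊎ v ∈ T) →
    (Prob G p T (u , false) (v , false) ≡ Prob G p T (u , false) (v , true))
    × (Prob G p T (u , false) (v , false) ≥ Prob G p T (u , false) (v , true))
mainTheorem2 G _ u v p _ T hyp = equal , ≤-reflexive (sym equal)
  where
  equal : Prob G p T (u , false) (v , false) ≡ Prob G p T (u , false) (v , true)
  equal = prob-layers-equal G u v p T hyp
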